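{- (i) For every context $\Gamma$: if $\Gamma\ \mathrm{ok}$ then $\Gamma\ \mathrm{ok}_s$. (ii) For every context $\Gamma$ and terms $M,A$: if $\Gamma\vdash M:A$ then $\Gamma\vdash_s M:A$.
   Context: Variables $\mathcal{V}$: a type with decidable equality and maps $\mathrm{encode}:\mathcal{V}\to\mathbb{N}$, $\mathrm{decode}:\mathbb{N}\to\mathcal{V}$ with $\mathrm{encode}(\mathrm{decode}\,n)=n$. Constants $\mathcal{C}$: any type. Terms: $\mathsf{c}\,k$, $\mathsf{v}\,x$, $\lambda[x:A]M$, $\Pi[x:A]B$, $M\cdot N$. Free-variable list: $\mathrm{fv}(\mathsf{c}\,k)=[\,]$, $\mathrm{fv}(\mathsf{v}\,x)=[x]$, $\mathrm{fv}(\lambda[x:A]M)=\mathrm{fv}\,A\mathbin{++}(\mathrm{fv}\,M-x)$, likewise $\Pi$, $\mathrm{fv}(M\cdot N)=\mathrm{fv}\,M\mathbin{++}\mathrm{fv}\,N$ ($xs-x$ removes all occurrences of $x$). Substitutions $\sigma:\mathcal{V}\to\Lambda$; $\iota\,x=\mathsf{v}\,x$; $(\sigma,x:=N)$ sends $x$ to $N$, $y\neq x$ to $\sigma\,y$. Fix $\chi':\mathrm{List}\,\mathbb{N}\to\mathbb{N}$ with $\chi'(ns)\notin ns$; $X'(xs)=\mathrm{decode}(\chi'(\mathrm{map\ encode}\ xs))$; $X(\sigma,xs)=X'$(concatenation of $\mathrm{fv}(\sigma\,y)$ for $y$ in $xs$). Substitution: $\mathsf{c}\,k\bullet\sigma=\mathsf{c}\,k$,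 $\mathsf{v}\,x\bullet\sigma=\sigma\,x$, $(M\cdot N)\bullet\sigma=(M\bullet\sigma)\cdot(N\bullet\sigma)$, $(\lambda[x:A]M)\bullet\sigma=\lambda[y:A\bullet\sigma](M\bullet(\sigma,x:=\mathsf{v}\,y))$ with $y=X(\sigma,\mathrm{fv}\,M-x)$, analogously for $\Pi$ (with $y=X(\sigma,\mathrm{fv}\,B-x)$). $M[x:=N]=M\bullet(\iota,x:=N)$. Alpha-conversion $\sim_\alpha$: inductive, $\mathsf{c}\,k\sim_\alpha\mathsf{c}\,k$, $\mathsf{v}\,x\sim_\alpha\mathsf{v}\,x$, congruence for application, and $\lambda[x:A]M\sim_\alpha\lambda[x':A']M'$ whenever $A\sim_\alpha A'$, $y\notin\mathrm{fv}\,M-x$, $y\notin\mathrm{fv}\,M'-x'$ and $M[x:=\mathsf{v}\,y]=M'[x':=\mathsf{v}\,y]$ syntactically, for some $y$ (same for $\Pi$). Beta: the contextual closure of a relation $S$ is the least relation containing $S$ and closed under rewriting in the body or annotation of $\lambda$, in the codomain or domain of $\Pi$, and in either side of an application; $\to_\beta$ is the contextual closure of $(\lambda[x:A]M)\cdot N\ \triangleright\ M[x:=N]$; $\simeq_\beta$ is the reflexive–symmetric–transitive closure of $\sim_\alpha\cup\to_\beta$. PTS: fix $\mathcal{A}\subseteq\mathcal{C}^2$ (axioms) and $\mathcal{R}\subseteq\mathcal{C}^3$ (rules). A context is a list of pairs $(x,A)$; $\Gamma,x:A$ denotes $(x,A)::\Gamma$; $\mathrm{dom}\,\Gamma$ is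 the list of first components. Infinitary system: the judgments $\Gamma\ \mathrm{ok}$ and $\Gamma\vdash M:A$ are mutually inductively defined by: (nil) $[\,]\ \mathrm{ok}$; (cons) if $\Gamma\ \mathrm{ok}$, $\Gamma\vdash A:\mathsf{c}\,s$ and $x\notin\mathrm{dom}\,\Gamma$ then $(\Gamma,x:A)\ \mathrm{ok}$; (sort) if $\Gamma\ \mathrm{ok}$ and $\mathcal{A}\,s_1\,s_2$ then $\Gamma\vdash\mathsf{c}\,s_1:\mathsf{c}\,s_2$; (prod) if $\Gamma\vdash A:\mathsf{c}\,s_1$, for every $y\notin\mathrm{dom}\,\Gamma$ we have $\Gamma,y:A\vdash B[x:=\mathsf{v}\,y]:\mathsf{c}\,s_2$, and $\mathcal{R}\,s_1\,s_2\,s_3$, then $\Gamma\vdash\Pi[x:A]B:\mathsf{c}\,s_3$; (var) if $\Gamma\ \mathrm{ok}$ and $(x,A)\in\Gamma$ then $\Gamma\vdash\mathsf{v}\,x:A$; (abs) if $\Gamma\vdash A:\mathsf{c}\,s_1$, for every $z\notin\mathrm{dom}\,\Gamma$ both $\Gamma,z:A\vdash B[y:=\mathsf{v}\,z]:\mathsf{c}\,s_2$ and $\Gamma,z:A\vdash M[x:=\mathsf{v}\,z]:B[y:=\mathsf{v}\,z]$, and $\mathcal{R}\,s_1\,s_2\,s_3$, then $\Gamma\vdash\lambda[x:A]M:\Pi[y:A]B$; (app) if $\Gamma\vdash M:\Pi[x:A]B$, $\Gamma\vdash N:A$ and $\Gamma\vdash B[x:=N]:\mathsf{c}\,s$, then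 $\Gamma\vdash M\cdot N:B[x:=N]$; (conv) if $\Gamma\vdash M:A$, $A\simeq_\beta B$ and $\Gamma\vdash B:\mathsf{c}\,s$ then $\Gamma\vdash M:B$. Standard (finitary) system: $\Gamma\ \mathrm{ok}_s$ and $\Gamma\vdash_s M:A$ are mutually inductively defined by: (nil) $[\,]\ \mathrm{ok}_s$; (cons) if $\Gamma\ \mathrm{ok}_s$, $\Gamma\vdash_s A:\mathsf{c}\,s$ and $x\notin\mathrm{dom}\,\Gamma$ then $(\Gamma,x:A)\ \mathrm{ok}_s$; (sort) if $\Gamma\ \mathrm{ok}_s$ and $\mathcal{A}\,s_1\,s_2$ then $\Gamma\vdash_s\mathsf{c}\,s_1:\mathsf{c}\,s_2$; (prod) if $\Gamma\vdash_s A:\mathsf{c}\,s_1$, $\Gamma,y:A\vdash_s B[x:=\mathsf{v}\,y]:\mathsf{c}\,s_2$, $\mathcal{R}\,s_1\,s_2\,s_3$ and $y\notin\mathrm{fv}\,B-x$, then $\Gamma\vdash_s\Pi[x:A]B:\mathsf{c}\,s_3$; (var) if $\Gamma\ \mathrm{ok}_s$ and $(x,A)\in\Gamma$ then $\Gamma\vdash_s\mathsf{v}\,x:A$; (abs) if $\Gamma\vdash_s A:\mathsf{c}\,s_1$, $\Gamma,z:A\vdash_s B[y:=\mathsf{v}\,z]:\mathsf{c}\,s_2$, $\Gamma,z:A\vdash_s M[x:=\mathsf{v}\,z]:B[y:=\mathsf{v}\,z]$, $\mathcal{R}\,s_1\,s_2\,s_3$, $z\notin\mathrm{fv}\,M-x$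 and $z\notin\mathrm{fv}\,B-y$, then $\Gamma\vdash_s\lambda[x:A]M:\Pi[y:A]B$; (app) if $\Gamma\vdash_s M:\Pi[x:A]B$ and $\Gamma\vdash_s N:A$ then $\Gamma\vdash_s M\cdot N:B[x:=N]$; (conv) if $\Gamma\vdash_s M:A$, $A\simeq_\beta B$ and $\Gamma\vdash_s B:\mathsf{c}\,s$ then $\Gamma\vdash_s M:B$. -}

module Defs where

open import Data.Nat using (ℕ)
open import Data.List using (List; []; _∷_; _++_; map; concatMap)
open import Data.List.Membership.Propositional using (_∈_; _∉_)
open import Data.Product using (_×_; _,_; proj₁)
open import Relation.Nullary using (yes; no)
open import Relation.Binary.Definitions using (DecidableEquality)
open import Relation.Binary.PropositionalEquality using (_≡_)

data Term (V C : Set) : Set where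
  c   : C → Term V C
  v   : V → Term V C
  lam : V → Term V C → Term V C → Term V C   -- lam x A M  =  λ[x:A]M
  pi  : V → Term V C → Term V C → Term V C   -- pi x A B   =  Π[x:A]B
  _·_ : Term V C → Term V C → Term V C

-- Parameters: decidable equality on variables, encode/decode with
-- encode (decode n) ≡ n, and a fresh-number function χ' with χ' ns ∉ ns.
-- (The hypotheses on encode/decode/χ' are taken as explicit premises of the
-- theorem; the definitions below only need the functions themselves.)
module Lambda {V C : Set} (_≟_ : DecidableEquality V)
              (encode : V → ℕ) (decode : ℕ → V) (χ' : List ℕ → ℕ) where

  Λ : Set
  Λ = Term V C

  _-_ : List V → V → List V
  [] - x = []
  (y ∷ ys) - x with y ≟ x
  ... | yes _ = ys - x
  ... | no  _ = y ∷ (ys - x)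

  fv : Λ → List V
  fv (c k) = []
  fv (v x) = x ∷ []
  fv (lam x A M) = fv A ++ (fv M - x)
  fv (pi x A B) = fv A ++ (fv B - x)
  fv (M · N) = fv M ++ fv N

  Subst : Set
  Subst = V → Λ

  ι : Subst
  ι x = v x

  _,_:=_ : Subst → V → Λ → Subst
  (σ , x := N) y with y ≟ x
  ... | yes _ = N
  ... | no  _ = σ y

  X' : List V → V
  X' xs = decode (χ' (map encode xs))

  X : Subst → List V → V
  X σ xs = X' (concatMap (λ y → fv (σ y)) xs)

  _●_ : Λ → Subst → Λ
  c k ● σ = c k
  v x ● σ = σ x
  (M · N) ● σ = (M ● σ) · (N ● σ)
  lam x A M ● σ = let y = X σ (fv M - x) in lam y (A ● σ) (M ● (σ , x := v y))
  pi x A B ● σ = let y = X σ (fv B - x) in pi y (A ● σ) (B ● (σ , x := v y))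

  infixl 30 _[_:=_]
  _[_:=_] : Λ → V → Λ → Λ
  M [ x := N ] = M ● (ι , x := N)

  data _∼α_ : Λ → Λ → Set where
    α-c   : ∀ k → c k ∼α c k
    α-v   : ∀ x → v x ∼α v x
    α-app : ∀ {M M' N N'} → M ∼α M' → N ∼α N' → (M · N) ∼α (M' · N')
    α-lam : ∀ {x x' A A' M M'} y → A ∼α A' → y ∉ (fv M - x) → y ∉ (fv M' - x')
          → M [ x := v y ] ≡ M' [ x' := v y ] → lam x A M ∼α lam x' A' M'
    α-pi  : ∀ {x x' A A' B B'} y → A ∼α A' → y ∉ (fv B - x) → y ∉ (fv B' - x')
          → B [ x := v y ] ≡ B' [ x' := v y ] → pi x A B ∼α pi x' A' B'

  data Ctx (S : Λ → Λ → Set) : Λ → Λ → Set where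
    base  : ∀ {M N} → S M N → Ctx S M N
    lamB  : ∀ {x A M M'} → Ctx S M M' → Ctx S (lam x A M) (lam x A M')
    lamA  : ∀ {x A A' M} → Ctx S A A' → Ctx S (lam x A M) (lam x A' M)
    piB   : ∀ {x A B B'} → Ctx S B B' → Ctx S (pi x A B) (pi x A B')
    piA   : ∀ {x A A' B} → Ctx S A A' → Ctx S (pi x A B) (pi x A' B)
    appL  : ∀ {M M' N} → Ctx S M M' → Ctx S (M · N) (M' · N)
    appR  : ∀ {M N N'} → Ctx S N N' → Ctx S (M · N) (M · N')

  data βroot : Λ → Λ → Set where
    β : ∀ x A M N → βroot (lam x A M · N) (M [ x := N ])

  _→β_ : Λ → Λ → Set
  _→β_ = Ctx βroot

  data _≃β_ : Λ → Λ → Set where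
    ≃-α     : ∀ {M N} → M ∼α N → M ≃β N
    ≃-β     : ∀ {M N} → M →β N → M ≃β N
    ≃-refl  : ∀ {M} → M ≃β M
    ≃-sym   : ∀ {M N} → M ≃β N → N ≃β M
    ≃-trans : ∀ {M N P} → M ≃β N → N ≃β P → M ≃β P

  Context : Set
  Context = List (V × Λ)

  dom : Context → List V
  dom Γ = map proj₁ Γ

  module PTS (𝒜 : C → C → Set) (ℛ : C → C → C → Set) where

    _,,_∶_ : Context → V → Λ → Context
    Γ ,, x ∶ A = (x , A) ∷ Γ

    infix 5 _⊢_∶_ _⊢ₛ_∶_
    infix 6 _,,_∶_
    data _ok : Context → Set
    data _⊢_∶_ : Context → Λ → Λ → Set

    data _ok where
      nil  : [] ok
      cons : ∀ {Γ x A s} → Γ ok → Γ ⊢ A ∶ c s → x ∉ dom Γ → (Γ ,, x ∶ A) ok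

    data _⊢_∶_ where
      sort : ∀ {Γ s₁ s₂} → Γ ok → 𝒜 s₁ s₂ → Γ ⊢ c s₁ ∶ c s₂
      prod : ∀ {Γ x A B s₁ s₂ s₃} → Γ ⊢ A ∶ c s₁
           → (∀ y → y ∉ dom Γ → (Γ ,, y ∶ A) ⊢ B [ x := v y ] ∶ c s₂)
           → ℛ s₁ s₂ s₃ → Γ ⊢ pi x A B ∶ c s₃
      var  : ∀ {Γ x A} → Γ ok → (x , A) ∈ Γ → Γ ⊢ v x ∶ A
      abs  : ∀ {Γ x y A B M s₁ s₂ s₃} → Γ ⊢ A ∶ c s₁
           → (∀ z → z ∉ dom Γ → (Γ ,, z ∶ A) ⊢ B [ y := v z ] ∶ c s₂)
           → (∀ z → z ∉ dom Γ → (Γ ,, z ∶ A) ⊢ M [ x := v z ] ∶ B [ y := v z ])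
           → ℛ s₁ s₂ s₃ → Γ ⊢ lam x A M ∶ pi y A B
      app  : ∀ {Γ x A B M N s} → Γ ⊢ M ∶ pi x A B → Γ ⊢ N ∶ A
           → Γ ⊢ B [ x := N ] ∶ c s → Γ ⊢ M · N ∶ B [ x := N ]
      conv : ∀ {Γ M A B s} → Γ ⊢ M ∶ A → A ≃β B → Γ ⊢ B ∶ c s → Γ ⊢ M ∶ B

    data _okₛ : Context → Set
    data _⊢ₛ_∶_ : Context → Λ → Λ → Set

    data _okₛ where
      nil  : [] okₛ
      cons : ∀ {Γ x A s} → Γ okₛ → Γ ⊢ₛ A ∶ c s → x ∉ dom Γ → (Γ ,, x ∶ A) okₛ

    data _⊢ₛ_∶_ where
      sort : ∀ {Γ s₁ s₂} → Γ okₛ → 𝒜 s₁ s₂ → Γ ⊢ₛ c s₁ ∶ c s₂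
      prod : ∀ {Γ x y A B s₁ s₂ s₃} → Γ ⊢ₛ A ∶ c s₁
           → (Γ ,, y ∶ A) ⊢ₛ B [ x := v y ] ∶ c s₂
           → ℛ s₁ s₂ s₃ → y ∉ (fv B - x) → Γ ⊢ₛ pi x A B ∶ c s₃
      var  : ∀ {Γ x A} → Γ okₛ → (x , A) ∈ Γ → Γ ⊢ₛ v x ∶ A
      abs  : ∀ {Γ x y z A B M s₁ s₂ s₃} → Γ ⊢ₛ A ∶ c s₁
           → (Γ ,, z ∶ A) ⊢ₛ B [ y := v z ] ∶ c s₂
           → (Γ ,, z ∶ A) ⊢ₛ M [ x := v z ] ∶ B [ y := v z ]
           → ℛ s₁ s₂ s₃ → z ∉ (fv M - x) → z ∉ (fv B - y)
           → Γ ⊢ₛ lam x A M ∶ pi y A B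
      app  : ∀ {Γ x A B M N} → Γ ⊢ₛ M ∶ pi x A B → Γ ⊢ₛ N ∶ A
           → Γ ⊢ₛ M · N ∶ B [ x := N ]
      conv : ∀ {Γ M A B s} → Γ ⊢ₛ M ∶ A → A ≃β B → Γ ⊢ₛ B ∶ c s → Γ ⊢ₛ M ∶ B

-- The infinitary rules (prod) and (abs) hold for every variable outside dom Γ,
-- so each can be instantiated at one particular variable that is, in addition,
-- fresh for the bodies, which is exactly the side condition of the standard
-- rules. Such a variable is X' applied to dom Γ together with those free-variable
-- lists; the rest is a structural induction on derivations.
module Submission where

open import Defs
open import Data.Nat using (ℕ)
open import Data.List using (List; map; _++_)
open import Data.List.Membership.Propositional using (_∉_; _∈_)
open import Data.List.Membership.Propositional.Properties using (∈-map⁺; ∈-++⁺ˡ; ∈-++⁺ʳ)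
open import Data.Product using (_×_; _,_)
open import Relation.Binary.Definitions using (DecidableEquality)
open import Relation.Binary.PropositionalEquality using (_≡_; subst)

∉-++⁻ : {A : Set} {z : A} (xs ys : List A) → z ∉ xs ++ ys → z ∉ xs × z ∉ ys
∉-++⁻ xs ys z∉xs++ys = (λ z∈xs → z∉xs++ys (∈-++⁺ˡ z∈xs)) , (λ z∈ys → z∉xs++ys (∈-++⁺ʳ xs z∈ys))

module Finitary {V C : Set} (_≟_ : DecidableEquality V)
    (encode : V → ℕ) (decode : ℕ → V) (encode-decode : ∀ n → encode (decode n) ≡ n)
    (χ' : List ℕ → ℕ) (χ'-fresh : ∀ ns → χ' ns ∉ ns)
    (𝒜 : C → C → Set) (ℛ : C → C → C → Set) where
  open Lambda {V} {C} _≟_ encode decode χ'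
  open PTS 𝒜 ℛ

  X'-fresh : ∀ xs → X' xs ∉ xs
  X'-fresh xs x∈xs = χ'-fresh (map encode xs)
    (subst (_∈ map encode xs) (encode-decode _) (∈-map⁺ encode x∈xs))

  ok⇒okₛ : ∀ {Γ} → Γ ok → Γ okₛ
  ⊢⇒⊢ₛ : ∀ {Γ M A} → Γ ⊢ M ∶ A → Γ ⊢ₛ M ∶ A

  ok⇒okₛ nil = nil
  ok⇒okₛ (cons Γ-ok ⊢A x∉Γ) = cons (ok⇒okₛ Γ-ok) (⊢⇒⊢ₛ ⊢A) x∉Γ

  ⊢⇒⊢ₛ (sort Γ-ok ax) = sort (ok⇒okₛ Γ-ok) ax
  ⊢⇒⊢ₛ {Γ} (prod {x = x} {B = B} ⊢A ⊢B rule)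
    with ∉-++⁻ (dom Γ) (fv B - x) (X'-fresh _)
  ... | y∉Γ , y∉B = prod (⊢⇒⊢ₛ ⊢A) (⊢⇒⊢ₛ (⊢B _ y∉Γ)) rule y∉B
  ⊢⇒⊢ₛ (var Γ-ok x∈Γ) = var (ok⇒okₛ Γ-ok) x∈Γ
  ⊢⇒⊢ₛ {Γ} (abs {x = x} {y = y} {B = B} {M = M} ⊢A ⊢B ⊢M rule)
    with ∉-++⁻ (dom Γ) ((fv M - x) ++ (fv B - y)) (X'-fresh _)
  ... | z∉Γ , z∉M++B with ∉-++⁻ (fv M - x) (fv B - y) z∉M++B
  ...   | z∉M , z∉B = abs (⊢⇒⊢ₛ ⊢A) (⊢⇒⊢ₛ (⊢B _ z∉Γ)) (⊢⇒⊢ₛ (⊢M _ z∉Γ)) rule z∉M z∉B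
  ⊢⇒⊢ₛ (app ⊢M ⊢N _) = app (⊢⇒⊢ₛ ⊢M) (⊢⇒⊢ₛ ⊢N)
  ⊢⇒⊢ₛ (conv ⊢M A≃B ⊢B) = conv (⊢⇒⊢ₛ ⊢M) A≃B (⊢⇒⊢ₛ ⊢B)

theorem3 : {V C : Set} (_≟_ : DecidableEquality V)
    (encode : V → ℕ) (decode : ℕ → V) → (∀ n → encode (decode n) ≡ n)
    → (χ' : List ℕ → ℕ) → (∀ ns → χ' ns ∉ ns)
    → (𝒜 : C → C → Set) (ℛ : C → C → C → Set)
    → let open Lambda {V} {C} _≟_ encode decode χ'
          open PTS 𝒜 ℛ
      in (∀ Γ → Γ ok → Γ okₛ) × (∀ Γ M A → Γ ⊢ M ∶ A → Γ ⊢ₛ M ∶ A)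
theorem3 _≟_ encode decode encode-decode χ' χ'-fresh 𝒜 ℛ =
  (λ _ → ok⇒okₛ) , (λ _ _ _ → ⊢⇒⊢ₛ)
  where open Finitary _≟_ encode decode encode-decode χ' χ'-fresh 𝒜 ℛ
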